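{- Let $d$ and $N$ be positive integers and let $A=\{U_1,\dots,U_N\}$ be a set of vectors from $\{0,1\}^d$, each treated as a binary string of length $d$. Define the morphisms $\mu,\tau:\{0,1\}^*\to\{0,1\}^*$ by $$\mu(0)=0111000,\quad \mu(1)=0001000,\quad \tau(0)=0011000,\quad \tau(1)=1111000,$$ (so $\mu(U)=\mu(U[1])\mu(U[2])\cdots\mu(U[d])$, and similarly for $\tau$), and let $H=\gamma^d$ where $\gamma=1001000$. For a positive integer $q$, let $$T_1=H^q\,\mu(U_1)\,H^q\,\mu(U_2)\,H^q\cdots\mu(U_N)\,H^q,\qquad T_2=H^q\,\tau(U_1)\,H^q\,\tau(U_2)\,H^q\cdots\tau(U_N)\,H^q,$$ and let $k=d$. Then: (a) If $A$ contains two orthogonal vectors $U_i,U_j$ (i.e.\ $\sum_{h=1}^d U_i[h]U_j[h]=0$), then the LCS with $k$ Mismatches problem for $T_1$ and $T_2$ has a solution of length at least $\ell=(14q+7)d$. (b) If $A$ does not contain two orthogonal vectors, then all solutions of the LCS with $k$ Mismatches problem for $T_1$ and $T_2$ have length smaller than $\ell'=(7q+14)d$.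
   Context: For equal-length strings $S_1,S_2$, $d_H(S_1,S_2)$ denotes the Hamming distance (number of positions where they differ). LCS with $k$ Mismatches: given strings $T_1,T_2$ (here of equal length) and an integer $k$, find a maximum-length substring of $T_1$ that occurs in $T_2$ with at most $k$ mismatches, i.e.\ find substrings $S_1$ of $T_1$ and $S_2$ of $T_2$ of equal, maximum possible length such that $d_H(S_1,S_2)\le k$; the length of such a substring is the length of the solution. -}

module Defs where

open import Data.Bool using (Bool; true; false; _∧_)
open import Data.Nat using (ℕ; zero; suc; _+_; _*_; _≤_; _<_)
open import Data.List using (List; []; _∷_; _++_; length; take; drop; concatMap; allFin; replicate; concat)
open import Data.Vec using (Vec; toList; zipWith)
import Data.Vec as V
open import Data.Fin using (Fin)
open import Relation.Binary.PropositionalEquality using (_≡_)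
open import Data.Product using (Σ; _×_; ∃; ∃-syntax)

Str : Set
Str = List Bool

-- Hamming distance (counts positions i < min(|S1|,|S2|) where they differ;
-- only ever applied to equal-length strings)
dH : Str → Str → ℕ
dH [] _ = 0
dH (_ ∷ _) [] = 0
dH (true ∷ xs) (true ∷ ys) = dH xs ys
dH (false ∷ xs) (false ∷ ys) = dH xs ys
dH (true ∷ xs) (false ∷ ys) = suc (dH xs ys)
dH (false ∷ xs) (true ∷ ys) = suc (dH xs ys)

substr : Str → ℕ → ℕ → Str
substr T i m = take m (drop i T)

-- There are substrings S1 of T1 and S2 of T2 of length m with d_H(S1,S2) ≤ k
-- (i.e. m is the length of a feasible candidate for LCS with k Mismatches).
CommonWithMismatches : Str → Str → ℕ → ℕ → Set
CommonWithMismatches T1 T2 k m =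
  ∃[ i ] ∃[ j ] (i + m ≤ length T1 × j + m ≤ length T2 ×
                 dH (substr T1 i m) (substr T2 j m) ≤ k)

μc : Bool → Str
μc false = false ∷ true ∷ true ∷ true ∷ false ∷ false ∷ false ∷ []
μc true  = false ∷ false ∷ false ∷ true ∷ false ∷ false ∷ false ∷ []

τc : Bool → Str
τc false = false ∷ false ∷ true ∷ true ∷ false ∷ false ∷ false ∷ []
τc true  = true ∷ true ∷ true ∷ true ∷ false ∷ false ∷ false ∷ []

γ : Str
γ = true ∷ false ∷ false ∷ true ∷ false ∷ false ∷ false ∷ []

μ : Str → Str
μ = concatMap μc

τ : Str → Str
τ = concatMap τc

pow : Str → ℕ → Str
pow w n = concat (replicate n w)

H : ℕ → Str
H d = pow γ d

buildT : (Str → Str) → (d N q : ℕ) → (Fin N → Vec Bool d) → Str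
buildT f d N q U = pow (H d) q ++ concatMap (λ i → f (toList (U i)) ++ pow (H d) q) (allFin N)

T₁ T₂ : (d N q : ℕ) → (Fin N → Vec Bool d) → Str
T₁ = buildT μ
T₂ = buildT τ

dot : {d : ℕ} → Vec Bool d → Vec Bool d → ℕ
dot u v = V.sum (zipWith (λ a b → if-nat (a ∧ b)) u v)
  where
  if-nat : Bool → ℕ
  if-nat true = 1
  if-nat false = 0

Orthogonal : {d : ℕ} → Vec Bool d → Vec Bool d → Set
Orthogonal u v = dot u v ≡ 0

{-# OPTIONS --safe #-}
-- Both texts are concatenations of 7-bit blocks of the common shape ∗∗∗1000: a block γ for each
-- position of the gaps H^q and a block μ(b) resp. τ(b) for each bit b of an encoded vector.
-- Aligned gap blocks agree and aligned bits b, b′ cost 1 + 2bb′, so the windows H^q μ(U_i) H^q and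
-- H^q τ(U_j) H^q differ in exactly d + 2⟨U_i,U_j⟩ positions.
-- Conversely, a window of length (7q + 14)d covers w = (q + 2)d − 1 whole blocks of T₁.  If the
-- opposite window of T₂ is not cut at block boundaries, the marker 1000 forces a mismatch in every
-- block.  If it is, both sides contain a complete encoded vector, since every w consecutive blocks of
-- the layout do.  A μ-block differs from every block of T₂ and a τ-block from every block of T₁, so
-- either the two vectors face each other, costing d + 2⟨U_i,U_j⟩ ≥ d + 2, or at least d + 1 blocks
-- mismatch.
module Submission where

open import Defs
open import Data.Bool using (Bool; true; false)
open import Data.Maybe using (Maybe; nothing; just)
open import Data.Nat using (ℕ; zero; suc; _+_; _*_; _∸_; _≤_; _<_; z≤n; s≤s; z<s; _≤?_; _<?_)
open import Data.Nat.Properties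
open import Data.Nat.DivMod using (_/_; _%_; m≡m%n+[m/n]*n; m%n<n)
open import Data.Nat.Tactic.RingSolver using (solve-∀)
open import Data.List using (List; []; _∷_; _++_; length; take; drop; concat; concatMap; map; replicate; allFin)
open import Data.List.Properties using (drop-drop; drop-[]; length-++; length-replicate; ++-assoc)
open import Data.List.Properties using (concatMap-++; concatMap-cong; concatMap-map; map-replicate)
open import Data.List.Membership.Propositional.Properties using (∈-∃++; ∈-allFin)
open import Data.Vec using (Vec; toList) renaming (_∷_ to _∷ᵥ_; [] to []ᵥ)
open import Data.Fin using (Fin)
open import Data.Product using (_×_; ∃-syntax; _,_; proj₁; proj₂)
open import Data.Empty using (⊥-elim)
open import Relation.Nullary using (¬_; yes; no)
open import Relation.Binary.PropositionalEquality
open import Relation.Binary.Definitions using (tri<; tri≈; tri>)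

module _ {A B : Set} (c : A → B → ℕ) where

  window : ℕ → List A → List B → ℕ
  window (suc n) (x ∷ xs) (y ∷ ys) = c x y + window n xs ys
  window _       _        _        = 0

  window-[]ˡ : ∀ n ys → window n [] ys ≡ 0
  window-[]ˡ zero    ys = refl
  window-[]ˡ (suc n) ys = refl

  window-[]ʳ : ∀ n xs → window n xs [] ≡ 0
  window-[]ʳ zero    xs       = refl
  window-[]ʳ (suc n) []       = refl
  window-[]ʳ (suc n) (x ∷ xs) = refl

  window-+ : ∀ m n xs ys →
             window (m + n) xs ys ≡ window m xs ys + window n (drop m xs) (drop m ys)
  window-+ zero    n xs       ys       = refl
  window-+ (suc m) n []       ys       = sym (window-[]ˡ n _)
  window-+ (suc m) n (x ∷ xs) []       = sym (window-[]ʳ n _)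
  window-+ (suc m) n (x ∷ xs) (y ∷ ys) =
    trans (cong (c x y +_) (window-+ m n xs ys)) (sym (+-assoc (c x y) _ _))

  window-++ : ∀ xs ys {xs′ ys′ n m} → length xs ≡ n → length ys ≡ n →
              window (n + m) (xs ++ xs′) (ys ++ ys′) ≡ window n xs ys + window m xs′ ys′
  window-++ []       []       refl refl = refl
  window-++ (x ∷ xs) (y ∷ ys) refl eq   =
    trans (cong (c x y +_) (window-++ xs ys refl (suc-injective eq))) (sym (+-assoc (c x y) _ _))

  window-prefix : ∀ xs ys {xs′ ys′ n} → length xs ≡ n → length ys ≡ n →
                  window n (xs ++ xs′) (ys ++ ys′) ≡ window n xs ys
  window-prefix []       []       refl refl = refl
  window-prefix (x ∷ xs) (y ∷ ys) refl eq   = cong (c x y +_) (window-prefix xs ys refl (suc-injective eq))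

  window-mono : ∀ {m n} xs ys → m ≤ n → window m xs ys ≤ window n xs ys
  window-mono {m} xs ys m≤n with m≤n⇒∃[o]m+o≡n m≤n
  ... | o , refl = ≤-trans (m≤m+n _ _) (≤-reflexive (sym (window-+ m o xs ys)))

  window-drop-≤ : ∀ e n {m} xs ys → e + n ≤ m → window n (drop e xs) (drop e ys) ≤ window m xs ys
  window-drop-≤ e n {m} xs ys e+n≤m = begin
    window n (drop e xs) (drop e ys)                        ≤⟨ m≤n+m _ _ ⟩
    window e xs ys + window n (drop e xs) (drop e ys)       ≡⟨ window-+ e n xs ys ⟨
    window (e + n) xs ys                                    ≤⟨ window-mono xs ys e+n≤m ⟩
    window m xs ys                                          ∎
    where
      open ≤-Reasoning

  window-disjoint : ∀ x n y n′ {m} xs ys → x + n ≤ y → y + n′ ≤ m →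
    window n (drop x xs) (drop x ys) + window n′ (drop y xs) (drop y ys) ≤ window m xs ys
  window-disjoint x n y n′ {m} xs ys x+n≤y y+n′≤m = begin
    window n (drop x xs) (drop x ys) + window n′ (drop y xs) (drop y ys)
      ≤⟨ +-monoˡ-≤ _ (window-drop-≤ x n xs ys x+n≤y) ⟩
    window y xs ys + window n′ (drop y xs) (drop y ys)  ≡⟨ window-+ y n′ xs ys ⟨
    window (y + n′) xs ys                               ≤⟨ window-mono xs ys y+n′≤m ⟩
    window m xs ys                                      ∎
    where
      open ≤-Reasoning

drop-length-++ : ∀ {A : Set} (xs : List A) {ys n} → length xs ≡ n → drop n (xs ++ ys) ≡ ys
drop-length-++ []       refl = refl
drop-length-++ (x ∷ xs) refl = drop-length-++ xs refl

drop-comm : ∀ {A : Set} m n (xs : List A) → drop m (drop n xs) ≡ drop n (drop m xs)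
drop-comm m n xs = begin
  drop m (drop n xs) ≡⟨ drop-drop n m xs ⟩
  drop (n + m) xs    ≡⟨ cong (λ k → drop k xs) (+-comm n m) ⟩
  drop (m + n) xs    ≡⟨ drop-drop m n xs ⟨
  drop n (drop m xs) ∎
  where
    open ≡-Reasoning

≤-length-drop : ∀ {A : Set} z {n} (xs : List A) → z + n ≤ length xs → n ≤ length (drop z xs)
≤-length-drop zero    xs       le      = le
≤-length-drop (suc z) (_ ∷ xs) (s≤s le) = ≤-length-drop z xs le

≤-length-infix : ∀ {A : Set} {L : List A} Z Y R → L ≡ Z ++ Y ++ R → length Z + length Y ≤ length L
≤-length-infix Z Y R refl = begin
  length Z + length Y                ≤⟨ +-monoʳ-≤ (length Z) (m≤m+n (length Y) (length R)) ⟩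
  length Z + (length Y + length R)   ≡⟨ cong (length Z +_) (length-++ Y) ⟨
  length Z + length (Y ++ R)         ≡⟨ length-++ Z ⟨
  length (Z ++ Y ++ R)               ∎
  where
    open ≤-Reasoning

OccursAt : {A : Set} → List A → ℕ → List A → Set
OccursAt xs x ys = ∃[ R ] drop x ys ≡ xs ++ R

occurs-drop : ∀ {A : Set} {xs ys : List A} a x → OccursAt xs (a + x) ys → OccursAt xs x (drop a ys)
occurs-drop {ys = ys} a x (R , eq) = R , trans (drop-drop a x ys) eq

module _ {A B : Set} {k : ℕ} (f : A → List B) (∣f∣ : ∀ a → length (f a) ≡ k) where

  length-concatMap : ∀ ts → length (concatMap f ts) ≡ length ts * k
  length-concatMap []       = refl
  length-concatMap (t ∷ ts) = trans (length-++ (f t)) (cong₂ _+_ (∣f∣ t) (length-concatMap ts))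

  drop-concatMap : ∀ n ts → drop (n * k) (concatMap f ts) ≡ concatMap f (drop n ts)
  drop-concatMap zero    ts       = refl
  drop-concatMap (suc n) []       = drop-[] (k + n * k)
  drop-concatMap (suc n) (t ∷ ts) = begin
    drop (k + n * k) (f t ++ concatMap f ts)        ≡⟨ drop-drop k (n * k) _ ⟨
    drop (n * k) (drop k (f t ++ concatMap f ts))   ≡⟨ cong (drop (n * k)) (drop-length-++ (f t) (∣f∣ t)) ⟩
    drop (n * k) (concatMap f ts)                   ≡⟨ drop-concatMap n ts ⟩
    concatMap f (drop n ts)                         ∎
    where
      open ≡-Reasoning

module _ {A A′ B B′ : Set} (c : B → B′ → ℕ) {k : ℕ}
         (f : A → List B) (g : A′ → List B′)
         (∣f∣ : ∀ a → length (f a) ≡ k) (∣g∣ : ∀ a → length (g a) ≡ k) where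

  window-concatMap : ∀ n ts ss →
    window c (n * k) (concatMap f ts) (concatMap g ss) ≡ window (λ a b → window c k (f a) (g b)) n ts ss
  window-concatMap zero    ts       ss       = refl
  window-concatMap (suc n) []       ss       = window-[]ˡ c (k + n * k) _
  window-concatMap (suc n) (t ∷ ts) []       = window-[]ʳ c (k + n * k) _
  window-concatMap (suc n) (t ∷ ts) (s ∷ ss) =
    trans (window-++ c (f t) (g s) (∣f∣ t) (∣g∣ s))
          (cong (window c k (f t) (g s) +_) (window-concatMap n ts ss))

interleave : {A K : Set} → List A → (K → List A) → List K → List A
interleave X G ks = X ++ concatMap (λ k → G k ++ X) ks

interleave-∷ : ∀ {A K : Set} (X : List A) (G : K → List A) k ks →
               interleave X G (k ∷ ks) ≡ (X ++ G k) ++ interleave X G ks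
interleave-∷ X G k ks = begin
  X ++ ((G k ++ X) ++ C)   ≡⟨ cong (X ++_) (++-assoc (G k) X C) ⟩
  X ++ (G k ++ (X ++ C))   ≡⟨ ++-assoc X (G k) (X ++ C) ⟨
  (X ++ G k) ++ (X ++ C)   ∎
  where
    open ≡-Reasoning
    C : List _
    C = concatMap (λ k → G k ++ X) ks

interleave-cong : ∀ {A K : Set} {X X′ : List A} {G G′ : K → List A} → X ≡ X′ → (∀ k → G k ≡ G′ k) →
                  ∀ ks → interleave X G ks ≡ interleave X′ G′ ks
interleave-cong {X = X} refl G≗G′ ks = cong (X ++_) (concatMap-cong (λ k → cong (_++ X) (G≗G′ k)) ks)

concatMap-interleave : ∀ {A B K : Set} (f : A → List B) X (G : K → List A) ks →
  concatMap f (interleave X G ks) ≡ interleave (concatMap f X) (λ k → concatMap f (G k)) ks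
concatMap-interleave f X G []       = concatMap-++ f X []
concatMap-interleave f X G (k ∷ ks) = begin
  concatMap f (interleave X G (k ∷ ks))
    ≡⟨ cong (concatMap f) (interleave-∷ X G k ks) ⟩
  concatMap f ((X ++ G k) ++ interleave X G ks)
    ≡⟨ concatMap-++ f (X ++ G k) _ ⟩
  concatMap f (X ++ G k) ++ concatMap f (interleave X G ks)
    ≡⟨ cong₂ _++_ (concatMap-++ f X (G k)) (concatMap-interleave f X G ks) ⟩
  (concatMap f X ++ concatMap f (G k)) ++ interleave (concatMap f X) G′ ks
    ≡⟨ interleave-∷ (concatMap f X) G′ k ks ⟨
  interleave (concatMap f X) G′ (k ∷ ks) ∎
  where
    open ≡-Reasoning
    G′ : _ → List _
    G′ k = concatMap f (G k)

interleave-split : ∀ {A K : Set} (X : List A) (G : K → List A) pre k post →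
  ∃[ Z ] ∃[ R ] interleave X G (pre ++ k ∷ post) ≡ Z ++ (X ++ G k ++ X) ++ R
interleave-split X G []        k post = [] , _ , sym (++-assoc X (G k ++ X) _)
interleave-split X G (k′ ∷ pre) k post with interleave-split X G pre k post
... | Z , R , eq = (X ++ G k′) ++ Z , R ,
  trans (interleave-∷ X G k′ (pre ++ k ∷ post))
        (trans (cong ((X ++ G k′) ++_) eq) (sym (++-assoc (X ++ G k′) Z _)))

module _ {A K : Set} (X : List A) (G : K → List A) {p n : ℕ}
         (∣X∣ : length X ≡ p) (∣G∣ : ∀ k → length (G k) ≡ suc n) where

  length-interleave-[] : length (interleave X G []) ≡ p
  length-interleave-[] = trans (length-++ X) (trans (+-identityʳ _) ∣X∣)

  length-period : ∀ k → length (X ++ G k) ≡ p + suc n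
  length-period k = trans (length-++ X) (cong₂ _+_ ∣X∣ (∣G∣ k))

  length-interleave-∷ : ∀ k ks →
    length (interleave X G (k ∷ ks)) ≡ p + suc n + length (interleave X G ks)
  length-interleave-∷ k ks = trans (cong length (interleave-∷ X G k ks))
                                   (trans (length-++ (X ++ G k)) (cong (_+ _) (length-period k)))

  drop-period : ∀ k ks m → drop (p + suc n + m) (interleave X G (k ∷ ks)) ≡ drop m (interleave X G ks)
  drop-period k ks m = begin
    drop (p + suc n + m) (interleave X G (k ∷ ks))
      ≡⟨ cong (drop (p + suc n + m)) (interleave-∷ X G k ks) ⟩
    drop (p + suc n + m) ((X ++ G k) ++ interleave X G ks)
      ≡⟨ drop-drop (p + suc n) m _ ⟨
    drop m (drop (p + suc n) ((X ++ G k) ++ interleave X G ks))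
      ≡⟨ cong (drop m) (drop-length-++ (X ++ G k) (length-period k)) ⟩
    drop m (interleave X G ks) ∎
    where
      open ≡-Reasoning

  occurs-first : ∀ k ks → OccursAt (G k) p (interleave X G (k ∷ ks))
  occurs-first k ks = X ++ concatMap (λ k → G k ++ X) ks ,
    trans (drop-length-++ X ∣X∣) (++-assoc (G k) X _)

  occurs-period : ∀ k ks {xs s} → OccursAt xs s (interleave X G ks) →
                  OccursAt xs (p + suc n + s) (interleave X G (k ∷ ks))
  occurs-period k ks (R , eq) = R , trans (drop-period k ks _) eq

  private
    w : ℕ
    w = p + suc n + n

    two-periods : ∀ {a} → p < a → p + suc n + p + suc n ≤ a + w
    two-periods {a} p<a = begin
      p + suc n + p + suc n  ≡⟨ rearrange p n ⟩
      suc p + w              ≤⟨ +-monoˡ-≤ w p<a ⟩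
      a + w                  ∎
      where
        open ≤-Reasoning
        rearrange : ∀ p n → p + suc n + p + suc n ≡ suc p + (p + suc n + n)
        rearrange = solve-∀

  -- The word found is G k itself if a ≤ p, the next word if a falls inside G k, and otherwise one
  -- found recursively in the remaining periods.
  word-in-window : ∀ ks a → a + w ≤ length (interleave X G ks) →
    ∃[ s ] ∃[ k ] a ≤ s × s + suc n ≤ a + w × OccursAt (G k) s (interleave X G ks)
  word-in-window [] a fits = ⊥-elim (<⇒≱ p<a+w (≤-trans fits (≤-reflexive length-interleave-[])))
    where
    p<a+w : p < a + w
    p<a+w = ≤-trans (m<m+n p z<s) (≤-trans (m≤m+n _ n) (m≤n+m w a))
  word-in-window (k ∷ ks) a fits with a ≤? p | p + suc n ≤? a
  ... | yes a≤p | _ = p , k , a≤p , ≤-trans (m≤m+n _ n) (m≤n+m w a) , occurs-first k ks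
  ... | no a≰p | no p+n≰a with ks
  ...   | [] = ⊥-elim (m+1+n≰m (p + suc n + p) (begin
            p + suc n + p + suc n                  ≤⟨ two-periods (≰⇒> a≰p) ⟩
            a + w                                  ≤⟨ fits ⟩
            length (interleave X G (k ∷ []))       ≡⟨ length-interleave-∷ k [] ⟩
            p + suc n + length (interleave X G []) ≡⟨ cong (p + suc n +_) length-interleave-[] ⟩
            p + suc n + p                          ∎))
    where
      open ≤-Reasoning
  ...   | k′ ∷ ks′ =
    p + suc n + p , k′ , ≤-trans (<⇒≤ (≰⇒> p+n≰a)) (m≤m+n _ p) , two-periods (≰⇒> a≰p) ,
    occurs-period k (k′ ∷ ks′) (occurs-first k′ ks′)
  word-in-window (k ∷ ks) a fits | no _ | yes p+n≤a with m≤n⇒∃[o]m+o≡n p+n≤a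
  ... | a′ , refl with word-in-window ks a′ (+-cancelˡ-≤ (p + suc n) _ _ (begin
          p + suc n + (a′ + w)                         ≡⟨ +-assoc (p + suc n) a′ w ⟨
          p + suc n + a′ + w                           ≤⟨ fits ⟩
          length (interleave X G (k ∷ ks))             ≡⟨ length-interleave-∷ k ks ⟩
          p + suc n + length (interleave X G ks)       ∎))
    where
      open ≤-Reasoning
  ... | s , k′ , a′≤s , s-fits , occ =
    p + suc n + s , k′ , +-monoʳ-≤ (p + suc n) a′≤s ,
    (begin
      p + suc n + s + suc n        ≡⟨ +-assoc (p + suc n) s (suc n) ⟩
      p + suc n + (s + suc n)      ≤⟨ +-monoʳ-≤ (p + suc n) s-fits ⟩
      p + suc n + (a′ + w)         ≡⟨ +-assoc (p + suc n) a′ w ⟨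
      p + suc n + a′ + w           ∎) ,
    occurs-period k ks occ
    where
      open ≤-Reasoning

  word-within : ∀ ks a → a + w ≤ length (interleave X G ks) →
    ∃[ x ] ∃[ k ] x + suc n ≤ w × OccursAt (G k) x (drop a (interleave X G ks))
  word-within ks a fits with word-in-window ks a fits
  ... | s , k , a≤s , s-fits , occ with m≤n⇒∃[o]m+o≡n a≤s
  ...   | x , refl = x , k , +-cancelˡ-≤ a _ _ (≤-trans (≤-reflexive (sym (+-assoc a x (suc n)))) s-fits) ,
                     occurs-drop a x occ

pow-+ : ∀ (w : Str) m n → pow w (m + n) ≡ pow w m ++ pow w n
pow-+ w zero    n = refl
pow-+ w (suc m) n = trans (cong (w ++_) (pow-+ w m n)) (sym (++-assoc w (pow w m) (pow w n)))

pow-* : ∀ (w : Str) q d → pow w (q * d) ≡ pow (pow w d) q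
pow-* w zero    d = refl
pow-* w (suc q) d = trans (pow-+ w d (q * d)) (cong (pow w d ++_) (pow-* w q d))

mismatch : Bool → Bool → ℕ
mismatch true  false = 1
mismatch false true  = 1
mismatch _     _     = 0

dH-take : ∀ m xs ys → dH (take m xs) (take m ys) ≡ window mismatch m xs ys
dH-take zero    xs           ys           = refl
dH-take (suc m) []           ys           = refl
dH-take (suc m) (x ∷ xs)     []           = refl
dH-take (suc m) (true ∷ xs)  (true ∷ ys)  = dH-take m xs ys
dH-take (suc m) (true ∷ xs)  (false ∷ ys) = cong suc (dH-take m xs ys)
dH-take (suc m) (false ∷ xs) (true ∷ ys)  = cong suc (dH-take m xs ys)
dH-take (suc m) (false ∷ xs) (false ∷ ys) = dH-take m xs ys

framed : Bool → Bool → Bool → Str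
framed a b c = a ∷ b ∷ c ∷ true ∷ false ∷ false ∷ false ∷ []

Framed : Str → Set
Framed s = ∃[ a ] ∃[ b ] ∃[ c ] s ≡ framed a b c

length-framed : ∀ {s} → Framed s → length s ≡ 7
length-framed (_ , _ , _ , refl) = refl

-- After a shift by 1 to 3 the marker 1 of x lies over one of the trailing 0s of y; after a shift
-- by 4 to 6 the marker of z lies over one of the trailing 0s of x.
shifted-framed-mismatch : ∀ {x y z} e e′ r → r < 6 → Framed x → Framed y → Framed z →
  1 ≤ window mismatch 7 (x ++ e) (drop (suc r) (y ++ z ++ e′))
shifted-framed-mismatch {x} {y} {z} e e′ r r<6 (_ , _ , _ , refl) (_ , _ , _ , refl) (_ , _ , _ , refl)
  with r | r<6
... | 0 | _ = window-drop-≤ mismatch 3 1 (x ++ e) (drop 1 (y ++ z ++ e′)) (m≤m+n 4 3)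
... | 1 | _ = window-drop-≤ mismatch 3 1 (x ++ e) (drop 2 (y ++ z ++ e′)) (m≤m+n 4 3)
... | 2 | _ = window-drop-≤ mismatch 3 1 (x ++ e) (drop 3 (y ++ z ++ e′)) (m≤m+n 4 3)
... | 3 | _ = window-drop-≤ mismatch 6 1 (x ++ e) (drop 4 (y ++ z ++ e′)) (m≤m+n 7 0)
... | 4 | _ = window-drop-≤ mismatch 5 1 (x ++ e) (drop 5 (y ++ z ++ e′)) (m≤m+n 6 1)
... | 5 | _ = window-drop-≤ mismatch 4 1 (x ++ e) (drop 6 (y ++ z ++ e′)) (m≤m+n 5 2)
... | suc (suc (suc (suc (suc (suc _))))) | s≤s (s≤s (s≤s (s≤s (s≤s (s≤s ())))))

block₁ block₂ : Maybe Bool → Str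
block₁ nothing  = γ
block₁ (just b) = μc b
block₂ nothing  = γ
block₂ (just b) = τc b

block₁-framed : ∀ t → Framed (block₁ t)
block₁-framed nothing      = _ , _ , _ , refl
block₁-framed (just false) = _ , _ , _ , refl
block₁-framed (just true)  = _ , _ , _ , refl

block₂-framed : ∀ t → Framed (block₂ t)
block₂-framed nothing      = _ , _ , _ , refl
block₂-framed (just false) = _ , _ , _ , refl
block₂-framed (just true)  = _ , _ , _ , refl

length-block₁ : ∀ t → length (block₁ t) ≡ 7
length-block₁ t = length-framed (block₁-framed t)

length-block₂ : ∀ t → length (block₂ t) ≡ 7
length-block₂ t = length-framed (block₂-framed t)

misaligned-cost : ∀ n ts ss r → r < 6 → n ≤ length ts → suc n ≤ length ss →
  n ≤ window mismatch (n * 7) (concatMap block₁ ts) (drop (suc r) (concatMap block₂ ss))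
misaligned-cost zero    _        _             _ _   _         _         = z≤n
misaligned-cost (suc n) (t ∷ ts) (s ∷ s′ ∷ ss) r r<6 (s≤s n≤ts) (s≤s n<ss) = begin
  1 + n
    ≤⟨ +-mono-≤ (shifted-framed-mismatch _ _ r r<6 (block₁-framed t) (block₂-framed s) (block₂-framed s′))
                (misaligned-cost n ts (s′ ∷ ss) r r<6 n≤ts n<ss) ⟩
  window mismatch 7 X Y + window mismatch (n * 7) (concatMap block₁ ts) (drop (suc r) (concatMap block₂ (s′ ∷ ss)))
    ≡⟨ cong₂ (λ xs ys → window mismatch 7 X Y + window mismatch (n * 7) xs ys)
             (drop-length-++ (block₁ t) (length-block₁ t))
             (trans (drop-comm 7 (suc r) (concatMap block₂ (s ∷ s′ ∷ ss)))
                    (cong (drop (suc r)) (drop-length-++ (block₂ s) (length-block₂ s)))) ⟨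
  window mismatch 7 X Y + window mismatch (n * 7) (drop 7 X) (drop 7 Y)
    ≡⟨ window-+ mismatch 7 (n * 7) X Y ⟨
  window mismatch (7 + n * 7) X Y ∎
  where
  open ≤-Reasoning
  X Y : Str
  X = concatMap block₁ (t ∷ ts)
  Y = drop (suc r) (concatMap block₂ (s ∷ s′ ∷ ss))

blockCost : Maybe Bool → Maybe Bool → ℕ
blockCost t s = window mismatch 7 (block₁ t) (block₂ s)

letter-blockˡ : ∀ b s → 1 ≤ blockCost (just b) s
letter-blockˡ false nothing      = s≤s z≤n
letter-blockˡ false (just false) = s≤s z≤n
letter-blockˡ false (just true)  = s≤s z≤n
letter-blockˡ true  nothing      = s≤s z≤n
letter-blockˡ true  (just false) = s≤s z≤n
letter-blockˡ true  (just true)  = s≤s z≤n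

letter-blockʳ : ∀ t b → 1 ≤ blockCost t (just b)
letter-blockʳ nothing      false = s≤s z≤n
letter-blockʳ nothing      true  = s≤s z≤n
letter-blockʳ (just false) false = s≤s z≤n
letter-blockʳ (just false) true  = s≤s z≤n
letter-blockʳ (just true)  false = s≤s z≤n
letter-blockʳ (just true)  true  = s≤s z≤n

letters : ∀ {n} → Vec Bool n → List (Maybe Bool)
letters u = map just (toList u)

length-letters : ∀ {n} (u : Vec Bool n) → length (letters u) ≡ n
length-letters []ᵥ       = refl
length-letters (_ ∷ᵥ u) = cong suc (length-letters u)

letters-mismatchˡ : ∀ {n} (u : Vec Bool n) R ss → n ≤ length ss →
  n ≤ window blockCost n (letters u ++ R) ss
letters-mismatchˡ []ᵥ       R ss       _        = z≤n
letters-mismatchˡ (b ∷ᵥ u) R (s ∷ ss) (s≤s n≤) =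
  +-mono-≤ (letter-blockˡ b s) (letters-mismatchˡ u R ss n≤)

letters-mismatchʳ : ∀ {n} (v : Vec Bool n) R ts → n ≤ length ts →
  n ≤ window blockCost n ts (letters v ++ R)
letters-mismatchʳ []ᵥ       R ts       _        = z≤n
letters-mismatchʳ (b ∷ᵥ v) R (t ∷ ts) (s≤s n≤) =
  +-mono-≤ (letter-blockʳ t b) (letters-mismatchʳ v R ts n≤)

letters-cost : ∀ {n} (u v : Vec Bool n) → window blockCost n (letters u) (letters v) ≡ n + 2 * dot u v
letters-cost []ᵥ          []ᵥ          = refl
letters-cost (false ∷ᵥ u) (false ∷ᵥ v) = cong suc (letters-cost u v)
letters-cost (false ∷ᵥ u) (true  ∷ᵥ v) = cong suc (letters-cost u v)
letters-cost (true  ∷ᵥ u) (false ∷ᵥ v) = cong suc (letters-cost u v)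
letters-cost {suc n} (true  ∷ᵥ u) (true  ∷ᵥ v) =
  trans (cong (3 +_) (letters-cost u v)) (shift n (dot u v))
  where
  shift : ∀ n D → 3 + (n + 2 * D) ≡ suc n + 2 * (1 + D)
  shift = solve-∀

gap : ℕ → List (Maybe Bool)
gap n = replicate n nothing

gap-cost : ∀ n → window blockCost n (gap n) (gap n) ≡ 0
gap-cost zero    = refl
gap-cost (suc n) = gap-cost n

first-letter : ∀ {n b} x ts (u : Vec Bool n) →
               OccursAt (letters (b ∷ᵥ u)) x ts → OccursAt (letters (b ∷ᵥ []ᵥ)) x ts
first-letter x ts u (R , eq) = letters u ++ R , eq

word-costˡ : ∀ {n} (u : Vec Bool n) x ts ss → OccursAt (letters u) x ts → x + n ≤ length ss →
             n ≤ window blockCost n (drop x ts) (drop x ss)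
word-costˡ {n} u x ts ss (R , eq) fits =
  subst (λ zs → n ≤ window blockCost n zs (drop x ss)) (sym eq)
        (letters-mismatchˡ u R (drop x ss) (≤-length-drop x ss fits))

word-costʳ : ∀ {n} (v : Vec Bool n) y ts ss → OccursAt (letters v) y ss → y + n ≤ length ts →
             n ≤ window blockCost n (drop y ts) (drop y ss)
word-costʳ {n} v y ts ss (R , eq) fits =
  subst (λ zs → n ≤ window blockCost n (drop y ts) zs) (sym eq)
        (letters-mismatchʳ v R (drop y ts) (≤-length-drop y ts fits))

aligned-cost : ∀ {d} w ts ss x y (u v : Vec Bool (suc d)) →
  w ≤ length ts → w ≤ length ss → x + suc d ≤ w → y + suc d ≤ w →
  OccursAt (letters u) x ts → OccursAt (letters v) y ss → 1 ≤ dot u v →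
  suc (suc d) ≤ window blockCost w ts ss
aligned-cost {d} w ts ss x y u@(b ∷ᵥ u′) v@(b′ ∷ᵥ v′) ∣ts∣ ∣ss∣ x-fits y-fits u-at v-at dot≥1
  with <-cmp x y
... | tri≈ _ refl _ = begin-strict
  suc d
    <⟨ m<m+n (suc d) (≤-trans dot≥1 (m≤m+n _ _)) ⟩
  suc d + 2 * dot u v
    ≡⟨ letters-cost u v ⟨
  window blockCost (suc d) (letters u) (letters v)
    ≡⟨ window-prefix blockCost (letters u) (letters v) (length-letters u) (length-letters v) ⟨
  window blockCost (suc d) (letters u ++ proj₁ u-at) (letters v ++ proj₁ v-at)
    ≡⟨ cong₂ (window blockCost (suc d)) (proj₂ u-at) (proj₂ v-at) ⟨
  window blockCost (suc d) (drop x ts) (drop x ss)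
    ≤⟨ window-drop-≤ blockCost x (suc d) ts ss x-fits ⟩
  window blockCost w ts ss ∎
  where
    open ≤-Reasoning
... | tri< x<y _ _ = begin
  1 + suc d
    ≤⟨ +-mono-≤ (word-costˡ (b ∷ᵥ []ᵥ) x ts ss (first-letter x ts u′ u-at)
                            (≤-trans (+-monoʳ-≤ x (s≤s z≤n)) (≤-trans x-fits ∣ss∣)))
                (word-costʳ v y ts ss v-at (≤-trans y-fits ∣ts∣)) ⟩
  window blockCost 1 (drop x ts) (drop x ss) + window blockCost (suc d) (drop y ts) (drop y ss)
    ≤⟨ window-disjoint blockCost x 1 y (suc d) ts ss (subst (_≤ y) (+-comm 1 x) x<y) y-fits ⟩
  window blockCost w ts ss ∎
  where
    open ≤-Reasoning
... | tri> _ _ y<x = begin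
  1 + suc d
    ≤⟨ +-mono-≤ (word-costʳ (b′ ∷ᵥ []ᵥ) y ts ss (first-letter y ss v′ v-at)
                            (≤-trans (+-monoʳ-≤ y (s≤s z≤n)) (≤-trans y-fits ∣ts∣)))
                (word-costˡ u x ts ss u-at (≤-trans x-fits ∣ss∣)) ⟩
  window blockCost 1 (drop y ts) (drop y ss) + window blockCost (suc d) (drop x ts) (drop x ss)
    ≤⟨ window-disjoint blockCost y 1 x (suc d) ts ss (subst (_≤ x) (+-comm 1 y) y<x) x-fits ⟩
  window blockCost w ts ss ∎
  where
    open ≤-Reasoning

concatMap-gap : ∀ (b : Maybe Bool → Str) n → concatMap b (gap n) ≡ pow (b nothing) n
concatMap-gap b n = cong concat (map-replicate b n nothing)

-- The tag nothing stands for a block γ and just b for the block of the bit b.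
layout : (d N q : ℕ) → (Fin N → Vec Bool d) → List (Maybe Bool)
layout d N q U = interleave (gap (q * d)) (λ i → letters (U i)) (allFin N)

buildT-blocks : ∀ (f : Str → Str) (b : Maybe Bool → Str) →
  b nothing ≡ γ → (∀ u → concatMap b (map just u) ≡ f u) →
  ∀ d N q U → buildT f d N q U ≡ concatMap b (layout d N q U)
buildT-blocks f b b-gap b-letters d N q U = sym (begin
  concatMap b (layout d N q U)
    ≡⟨ concatMap-interleave b (gap (q * d)) (λ i → letters (U i)) (allFin N) ⟩
  interleave (concatMap b (gap (q * d))) (λ i → concatMap b (letters (U i))) (allFin N)
    ≡⟨ interleave-cong gap-blocks (λ i → b-letters (toList (U i))) (allFin N) ⟩
  buildT f d N q U ∎)
  where
  open ≡-Reasoning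
  gap-blocks : concatMap b (gap (q * d)) ≡ pow (H d) q
  gap-blocks = trans (concatMap-gap b (q * d))
                     (trans (cong (λ g → pow g (q * d)) b-gap) (pow-* γ q d))

T₁-blocks : ∀ d N q U → T₁ d N q U ≡ concatMap block₁ (layout d N q U)
T₁-blocks = buildT-blocks μ block₁ refl (concatMap-map block₁ just)

T₂-blocks : ∀ d N q U → T₂ d N q U ≡ concatMap block₂ (layout d N q U)
T₂-blocks = buildT-blocks τ block₂ refl (concatMap-map block₂ just)

block-match : ∀ L₁ L₂ a c ℓ {k} → a + ℓ ≤ length L₁ → c + ℓ ≤ length L₂ →
  window blockCost ℓ (drop a L₁) (drop c L₂) ≤ k →
  CommonWithMismatches (concatMap block₁ L₁) (concatMap block₂ L₂) k (ℓ * 7)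
block-match L₁ L₂ a c ℓ a-fits c-fits cost≤k =
  a * 7 , c * 7 , fits block₁ length-block₁ L₁ a a-fits , fits block₂ length-block₂ L₂ c c-fits ,
  ≤-trans (≤-reflexive cost) cost≤k
  where
  fits : ∀ b (∣b∣ : ∀ t → length (b t) ≡ 7) L a →
         a + ℓ ≤ length L → a * 7 + ℓ * 7 ≤ length (concatMap b L)
  fits b ∣b∣ L a a-fits = begin
    a * 7 + ℓ * 7           ≡⟨ *-distribʳ-+ 7 a ℓ ⟨
    (a + ℓ) * 7             ≤⟨ *-monoˡ-≤ 7 a-fits ⟩
    length L * 7            ≡⟨ length-concatMap b ∣b∣ L ⟨
    length (concatMap b L)  ∎
    where
      open ≤-Reasoning
  cost : dH (substr (concatMap block₁ L₁) (a * 7) (ℓ * 7)) (substr (concatMap block₂ L₂) (c * 7) (ℓ * 7))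
       ≡ window blockCost ℓ (drop a L₁) (drop c L₂)
  cost = begin
    dH (substr (concatMap block₁ L₁) (a * 7) (ℓ * 7)) (substr (concatMap block₂ L₂) (c * 7) (ℓ * 7))
      ≡⟨ dH-take (ℓ * 7) _ _ ⟩
    window mismatch (ℓ * 7) (drop (a * 7) (concatMap block₁ L₁)) (drop (c * 7) (concatMap block₂ L₂))
      ≡⟨ cong₂ (window mismatch (ℓ * 7)) (drop-concatMap block₁ length-block₁ a L₁)
                                         (drop-concatMap block₂ length-block₂ c L₂) ⟩
    window mismatch (ℓ * 7) (concatMap block₁ (drop a L₁)) (concatMap block₂ (drop c L₂))
      ≡⟨ window-concatMap mismatch block₁ block₂ length-block₁ length-block₂ ℓ _ _ ⟩
    window blockCost ℓ (drop a L₁) (drop c L₂) ∎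
    where
      open ≡-Reasoning

padded : ∀ {d} → ℕ → Vec Bool d → List (Maybe Bool)
padded p u = gap p ++ letters u ++ gap p

length-padded : ∀ {d} p (u : Vec Bool d) → length (padded p u) ≡ p + (d + p)
length-padded p u =
  trans (length-++ (gap p))
        (cong₂ _+_ (length-replicate p)
                   (trans (length-++ (letters u)) (cong₂ _+_ (length-letters u) (length-replicate p))))

padded-cost : ∀ {d} p (u v : Vec Bool d) →
              window blockCost (p + (d + p)) (padded p u) (padded p v) ≡ d + 2 * dot u v
padded-cost {d} p u v = begin
  window blockCost (p + (d + p)) (padded p u) (padded p v)
    ≡⟨ window-++ blockCost (gap p) (gap p) (length-replicate p) (length-replicate p) ⟩
  window blockCost p (gap p) (gap p) + window blockCost (d + p) (letters u ++ gap p) (letters v ++ gap p)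
    ≡⟨ cong₂ _+_ (gap-cost p)
                 (window-++ blockCost (letters u) (letters v) (length-letters u) (length-letters v)) ⟩
  window blockCost d (letters u) (letters v) + window blockCost p (gap p) (gap p)
    ≡⟨ cong₂ _+_ (letters-cost u v) (gap-cost p) ⟩
  d + 2 * dot u v + 0
    ≡⟨ +-identityʳ _ ⟩
  d + 2 * dot u v ∎
  where
    open ≡-Reasoning

padded-occurs : ∀ d N q (U : Fin N → Vec Bool d) k →
                ∃[ Z ] ∃[ R ] layout d N q U ≡ Z ++ padded (q * d) (U k) ++ R
padded-occurs d N q U k with ∈-∃++ (∈-allFin k)
... | pre , post , allFin≡ with interleave-split (gap (q * d)) (λ i → letters (U i)) pre k post
...   | Z , R , split = Z , R , trans (cong (interleave (gap (q * d)) (λ i → letters (U i))) allFin≡) split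

padded-match : ∀ L Z R Z′ R′ p {d} (u v : Vec Bool d) →
  L ≡ Z ++ padded p u ++ R → L ≡ Z′ ++ padded p v ++ R′ →
  CommonWithMismatches (concatMap block₁ L) (concatMap block₂ L) (d + 2 * dot u v) ((p + (d + p)) * 7)
padded-match L Z R Z′ R′ p {d} u v u-at v-at =
  block-match L L (length Z) (length Z′) (p + (d + p))
              (fits Z R u u-at) (fits Z′ R′ v v-at) (≤-reflexive cost)
  where
  fits : ∀ Z R u → L ≡ Z ++ padded p u ++ R → length Z + (p + (d + p)) ≤ length L
  fits Z R u at =
    subst (λ ℓ → length Z + ℓ ≤ length L) (length-padded p u) (≤-length-infix Z (padded p u) R at)
  cost : window blockCost (p + (d + p)) (drop (length Z) L) (drop (length Z′) L) ≡ d + 2 * dot u v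
  cost = begin
    window blockCost (p + (d + p)) (drop (length Z) L) (drop (length Z′) L)
      ≡⟨ cong₂ (window blockCost (p + (d + p)))
               (trans (cong (drop (length Z)) u-at) (drop-length-++ Z refl))
               (trans (cong (drop (length Z′)) v-at) (drop-length-++ Z′ refl)) ⟩
    window blockCost (p + (d + p)) (padded p u ++ R) (padded p v ++ R′)
      ≡⟨ window-prefix blockCost (padded p u) (padded p v) (length-padded p u) (length-padded p v) ⟩
    window blockCost (p + (d + p)) (padded p u) (padded p v)
      ≡⟨ padded-cost p u v ⟩
    d + 2 * dot u v ∎
    where
      open ≡-Reasoning

orthogonal-pair-match : ∀ d N q (U : Fin N → Vec Bool d) i j → Orthogonal (U i) (U j) →
  CommonWithMismatches (T₁ d N q U) (T₂ d N q U) d ((14 * q + 7) * d)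
orthogonal-pair-match d N q U i j orth with padded-occurs d N q U i | padded-occurs d N q U j
... | Z , R , i-at | Z′ , R′ , j-at =
  subst₂ (CommonWithMismatches (T₁ d N q U) (T₂ d N q U)) mismatches total-length
    (subst₂ (λ S₁ S₂ → CommonWithMismatches S₁ S₂ _ _)
            (sym (T₁-blocks d N q U)) (sym (T₂-blocks d N q U))
            (padded-match (layout d N q U) Z R Z′ R′ (q * d) (U i) (U j) i-at j-at))
  where
  mismatches : d + 2 * dot (U i) (U j) ≡ d
  mismatches = trans (cong (λ x → d + 2 * x) orth) (+-identityʳ d)
  total-length : (q * d + (d + q * d)) * 7 ≡ (14 * q + 7) * d
  total-length = expand q d
    where
    expand : ∀ q d → (q * d + (d + q * d)) * 7 ≡ (14 * q + 7) * d
    expand = solve-∀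

-- i + r₀ is the first block boundary after i, so r₀ = 7 (not 0) when i is itself a boundary.
align-to-blocks : ∀ i j →
  ∃[ r₀ ] ∃[ a ] ∃[ c ] ∃[ r ] r₀ ≤ 7 × r < 7 × i + r₀ ≡ a * 7 × j + r₀ ≡ c * 7 + r
align-to-blocks i j =
  7 ∸ i % 7 , suc (i / 7) , j′ / 7 , j′ % 7 ,
  m∸n≤m 7 (i % 7) , m%n<n j′ 7 , round-up , trans (m≡m%n+[m/n]*n j′ 7) (+-comm (j′ % 7) (j′ / 7 * 7))
  where
  open ≡-Reasoning
  j′ : ℕ
  j′ = j + (7 ∸ i % 7)
  round-up : i + (7 ∸ i % 7) ≡ suc (i / 7) * 7
  round-up = begin
    i + (7 ∸ i % 7)                     ≡⟨ cong (_+ (7 ∸ i % 7)) (m≡m%n+[m/n]*n i 7) ⟩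
    i % 7 + i / 7 * 7 + (7 ∸ i % 7)     ≡⟨ rearrange (i % 7) (i / 7 * 7) (7 ∸ i % 7) ⟩
    i / 7 * 7 + (i % 7 + (7 ∸ i % 7))   ≡⟨ cong (i / 7 * 7 +_) (m+[n∸m]≡n (<⇒≤ (m%n<n i 7))) ⟩
    i / 7 * 7 + 7                       ≡⟨ +-comm (i / 7 * 7) 7 ⟩
    suc (i / 7) * 7                     ∎
    where
    rearrange : ∀ x y z → x + y + z ≡ y + (x + z)
    rearrange = solve-∀

-- Vectors have length suc d here, so d is one less than in the theorem, and w = (q + 2)(d + 1) − 1
-- is the number of whole blocks inside a window of length (7q + 14)(d + 1).
module _ (d N q : ℕ) (U : Fin N → Vec Bool (suc d)) (q≥1 : 1 ≤ q)
         (no-orth : ¬ (∃[ i ] ∃[ j ] Orthogonal (U i) (U j))) where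

  private
    p w : ℕ
    p = q * suc d
    w = p + suc d + d
    L : List (Maybe Bool)
    L = layout (suc d) N q U
    S₁ S₂ : Str
    S₁ = concatMap block₁ L
    S₂ = concatMap block₂ L

  dot-positive : ∀ i j → 1 ≤ dot (U i) (U j)
  dot-positive i j = n≢0⇒n>0 (λ orth → no-orth (i , j , orth))

  word-within-layout : ∀ a → a + w ≤ length L →
    ∃[ x ] ∃[ k ] x + suc d ≤ w × OccursAt (letters (U k)) x (drop a L)
  word-within-layout = word-within (gap p) (λ k → letters (U k))
                                   (length-replicate p) (λ k → length-letters (U k)) (allFin N)

  aligned-window : ∀ a c → a + w ≤ length L → c + w ≤ length L →
                   suc (suc d) ≤ window blockCost w (drop a L) (drop c L)
  aligned-window a c a-fits c-fits with word-within-layout a a-fits | word-within-layout c c-fits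
  ... | x , i , x-fits , u-at | y , j , y-fits , v-at =
    aligned-cost w (drop a L) (drop c L) x y (U i) (U j) (≤-length-drop a L a-fits) (≤-length-drop c L c-fits)
                 x-fits y-fits u-at v-at (dot-positive i j)

  w-large : suc (suc d) ≤ w
  w-large = ≤-trans (+-monoˡ-≤ (suc d) (*-mono-≤ q≥1 (s≤s z≤n))) (m≤m+n (p + suc d) d)

  block-window : ∀ a c r → r < 7 → a + w ≤ length L → (c + w) * 7 + r ≤ length L * 7 →
    suc (suc d) ≤ window mismatch (w * 7) (drop (a * 7) S₁) (drop (c * 7 + r) S₂)
  block-window a c zero _ a-fits c-fits = begin
    suc (suc d)
      ≤⟨ aligned-window a c a-fits c-fits′ ⟩
    window blockCost w (drop a L) (drop c L)
      ≡⟨ window-concatMap mismatch block₁ block₂ length-block₁ length-block₂ w (drop a L) (drop c L) ⟨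
    window mismatch (w * 7) (concatMap block₁ (drop a L)) (concatMap block₂ (drop c L))
      ≡⟨ cong₂ (window mismatch (w * 7)) (drop-concatMap block₁ length-block₁ a L)
               (trans (cong (λ k → drop k S₂) (+-identityʳ (c * 7)))
                      (drop-concatMap block₂ length-block₂ c L)) ⟨
    window mismatch (w * 7) (drop (a * 7) S₁) (drop (c * 7 + 0) S₂) ∎
    where
    open ≤-Reasoning
    c-fits′ : c + w ≤ length L
    c-fits′ = *-cancelʳ-≤ (c + w) (length L) 7 (subst (_≤ length L * 7) (+-identityʳ _) c-fits)
  block-window a c (suc r) r<7 a-fits c-fits = begin
    suc (suc d)
      ≤⟨ w-large ⟩
    w
      ≤⟨ misaligned-cost w (drop a L) (drop c L) r (≤-pred r<7)
                         (≤-length-drop a L a-fits) (≤-length-drop c L c-fits′) ⟩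
    window mismatch (w * 7) (concatMap block₁ (drop a L)) (drop (suc r) (concatMap block₂ (drop c L)))
      ≡⟨ cong₂ (window mismatch (w * 7)) (drop-concatMap block₁ length-block₁ a L)
               (trans (sym (drop-drop (c * 7) (suc r) S₂))
                      (cong (drop (suc r)) (drop-concatMap block₂ length-block₂ c L))) ⟨
    window mismatch (w * 7) (drop (a * 7) S₁) (drop (c * 7 + suc r) S₂) ∎
    where
    open ≤-Reasoning
    c-fits′ : c + suc w ≤ length L
    c-fits′ = subst (_≤ length L) (sym (+-suc c w))
                (*-cancelʳ-< 7 (c + w) (length L) (≤-trans (m<m+n ((c + w) * 7) z<s) c-fits))

  blocks-inside : ∀ i j m r₀ a c r →
    (7 * q + 14) * suc d ≤ m → r₀ ≤ 7 → i + r₀ ≡ a * 7 → j + r₀ ≡ c * 7 + r →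
    i + m ≤ length S₁ → j + m ≤ length S₂ →
    r₀ + w * 7 ≤ m × a + w ≤ length L × (c + w) * 7 + r ≤ length L * 7
  blocks-inside i j m r₀ a c r long r₀≤7 i-round j-round i-fits j-fits =
    r₀+w≤m ,
    *-cancelʳ-≤ (a + w) (length L) 7 (begin
      (a + w) * 7             ≡⟨ *-distribʳ-+ 7 a w ⟩
      a * 7 + w * 7           ≡⟨ cong (_+ w * 7) i-round ⟨
      i + r₀ + w * 7          ≤⟨ shifted-fits i S₁ i-fits ⟩
      length S₁               ≡⟨ length-concatMap block₁ length-block₁ L ⟩
      length L * 7            ∎) ,
    (begin
      (c + w) * 7 + r         ≡⟨ rearrange c w r ⟩
      c * 7 + r + w * 7       ≡⟨ cong (_+ w * 7) j-round ⟨
      j + r₀ + w * 7          ≤⟨ shifted-fits j S₂ j-fits ⟩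
      length S₂               ≡⟨ length-concatMap block₂ length-block₂ L ⟩
      length L * 7            ∎)
    where
    open ≤-Reasoning
    window-length : ∀ q d → 7 + (q * suc d + suc d + d) * 7 ≡ (7 * q + 14) * suc d
    window-length = solve-∀
    rearrange : ∀ c w r → (c + w) * 7 + r ≡ c * 7 + r + w * 7
    rearrange = solve-∀
    r₀+w≤m : r₀ + w * 7 ≤ m
    r₀+w≤m = ≤-trans (+-monoˡ-≤ (w * 7) r₀≤7) (≤-trans (≤-reflexive (window-length q d)) long)
    shifted-fits : ∀ x (S : Str) → x + m ≤ length S → x + r₀ + w * 7 ≤ length S
    shifted-fits x S fits =
      ≤-trans (≤-reflexive (+-assoc x r₀ (w * 7))) (≤-trans (+-monoʳ-≤ x r₀+w≤m) fits)

  long-window : ∀ i j m → (7 * q + 14) * suc d ≤ m → i + m ≤ length S₁ → j + m ≤ length S₂ →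
    suc (suc d) ≤ dH (substr S₁ i m) (substr S₂ j m)
  long-window i j m long i-fits j-fits with align-to-blocks i j
  ... | r₀ , a , c , r , r₀≤7 , r<7 , i-round , j-round =
    let r₀+w≤m , a-fits , c-fits = blocks-inside i j m r₀ a c r long r₀≤7 i-round j-round i-fits j-fits
    in begin
    suc (suc d)
      ≤⟨ block-window a c r r<7 a-fits c-fits ⟩
    window mismatch (w * 7) (drop (a * 7) S₁) (drop (c * 7 + r) S₂)
      ≡⟨ cong₂ (λ x y → window mismatch (w * 7) (drop x S₁) (drop y S₂)) i-round j-round ⟨
    window mismatch (w * 7) (drop (i + r₀) S₁) (drop (j + r₀) S₂)
      ≡⟨ cong₂ (window mismatch (w * 7)) (drop-drop i r₀ S₁) (drop-drop j r₀ S₂) ⟨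
    window mismatch (w * 7) (drop r₀ (drop i S₁)) (drop r₀ (drop j S₂))
      ≤⟨ window-drop-≤ mismatch r₀ (w * 7) (drop i S₁) (drop j S₂) r₀+w≤m ⟩
    window mismatch m (drop i S₁) (drop j S₂)
      ≡⟨ dH-take m (drop i S₁) (drop j S₂) ⟨
    dH (substr S₁ i m) (substr S₂ j m) ∎
    where
    open ≤-Reasoning

  no-orthogonal-pair-bound : ∀ m → CommonWithMismatches (T₁ (suc d) N q U) (T₂ (suc d) N q U) (suc d) m →
    m < (7 * q + 14) * suc d
  no-orthogonal-pair-bound m common
    with m <? (7 * q + 14) * suc d
       | subst₂ (λ T T′ → CommonWithMismatches T T′ (suc d) m)
                (T₁-blocks (suc d) N q U) (T₂-blocks (suc d) N q U) common
  ... | yes short | _ = short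
  ... | no m≮     | i , j , i-fits , j-fits , cost≤d =
    ⊥-elim (<⇒≱ (long-window i j m (≮⇒≥ m≮) i-fits j-fits) cost≤d)

lemma1 : (d N q : ℕ) → 1 ≤ d → 1 ≤ N → 1 ≤ q → (U : Fin N → Vec Bool d) →
    ((∃[ i ] ∃[ j ] Orthogonal (U i) (U j)) →
      ∃[ m ] ((14 * q + 7) * d ≤ m × CommonWithMismatches (T₁ d N q U) (T₂ d N q U) d m))
  × ((¬ (∃[ i ] ∃[ j ] Orthogonal (U i) (U j))) →
      ∀ m → CommonWithMismatches (T₁ d N q U) (T₂ d N q U) d m → m < (7 * q + 14) * d)
lemma1 (suc d) N q _ _ q≥1 U =
    (λ (i , j , orth) → (14 * q + 7) * suc d , ≤-refl , orthogonal-pair-match (suc d) N q U i j orth)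
  , no-orthogonal-pair-bound d N q U q≥1
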